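{- Let $X,Y$ be finite multisets of non-negative integers with $s(Y)=s(X)-1$. Denote by $x_i$ and $y_i$ the $i$-th largest elements of $X$ and $Y$ respectively, with $x_i=0$ for $i>|X|$ and $y_i=0$ for $i>|Y|$ (so $s_k(X)=\sum_{i\leqslant k}x_i$, $s_k(Y)=\sum_{i\leqslant k}y_i$). Assume that $s_k(X)\geqslant s_k(Y)\geqslant s_k(X)-1$ for all $k$, and let $m$ be a positive integer such that $s_k(X)=s_k(Y)$ for all $k=1,2,\ldots,m-1$. Then $x_m>0$ and $$Y\succ (X\cup\{x_m-1\})\setminus\{x_m\},$$ where the right-hand side is the multiset obtained from $X$ by replacing one copy of $x_m$ with $x_m-1$.
   Context: For a finite multiset $X$ of non-negative numbers and a non-negative integer $k$, $s_k(X)$ denotes the sum of the $\min(k,|X|)$ largest elements of $X$ (counted with multiplicity), and $s(X)=s_{|X|}(X)$ is the sum of all elements of $X$. We say $X$ majorizes $Y$, written $X\succ Y$, if $s(X)=s(Y)$ and $s_k(X)\geqslant s_k(Y)$ for all $k$. -}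

module Defs where

open import Data.Nat using (ℕ; zero; suc; _≤_; _≟_)
open import Data.Nat.Properties using (≤-decTotalOrder)
open import Data.List using (List; []; _∷_; take)
open import Data.Nat.ListAction using (sum)
open import Data.Product using (_×_)
open import Relation.Nullary using (yes; no)
open import Relation.Binary.PropositionalEquality using (_≡_)
open import Relation.Binary.Properties.DecTotalOrder ≤-decTotalOrder using (≥-decTotalOrder)
import Data.List.Sort as Sort

-- Finite multisets of naturals are represented by lists (order irrelevant:
-- every notion below is invariant under permutation).

sortDesc : List ℕ → List ℕ
sortDesc = Sort.sort ≥-decTotalOrder

sk : ℕ → List ℕ → ℕ
sk k X = sum (take k (sortDesc X))

stot : List ℕ → ℕ
stot X = sum X

at : List ℕ → ℕ → ℕ
at []       _       = 0
at (x ∷ xs) zero    = x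
at (x ∷ xs) (suc n) = at xs n

-- x_i : the i-th largest element (1-based), 0 if i > |X| (and for i = 0)
largest : ℕ → List ℕ → ℕ
largest zero    X = 0
largest (suc i) X = at (sortDesc X) i

removeOne : ℕ → List ℕ → List ℕ
removeOne a []       = []
removeOne a (x ∷ xs) with a ≟ x
... | yes _ = xs
... | no  _ = x ∷ removeOne a xs

_≻_ : List ℕ → List ℕ → Set
X ≻ Y = (stot X ≡ stot Y) × (∀ k → sk k Y ≤ sk k X)

module Submission where

-- Write S and T for X and Y sorted non-increasingly, so that s_k(X) and s_k(Y) are
-- the prefix sums of S and T, and let q = m - 1 be the 0-based position of x_m.
-- (1) If x_m = S[q] were 0, all later entries of S would vanish, so
--     s(X) = s_q(X) = s_q(Y) ≤ s(Y), contradicting s(Y) = s(X) - 1.  Hence x_m > 0.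
-- (2) Let p ≥ q be the end of the run of entries equal to x_m in S.  Decrementing
--     S at position p keeps it sorted and rearranges Z = (X ∪ {x_m - 1}) ∖ {x_m},
--     so sorted Z is S decremented at p: s_k(Z) = s_k(X) for k ≤ p and
--     s_k(Z) = s_k(X) - 1 for k > p.
-- (3) For k > p, s_k(X) ≤ s_k(Y) + 1 gives s_k(Z) ≤ s_k(Y).  For k ≤ p, an excess
--     s_k(X) = s_k(Y) + 1 would propagate downwards along the run (S is constant
--     there, T is non-increasing) down to q, where the prefix sums agree.

open import Defs
open import Data.Nat using (ℕ; zero; suc; _+_; _≤_; _<_; _∸_; z≤n; s≤s; s≤s⁻¹; _≤?_; _≟_)
open import Data.Nat.Properties
open import Data.Nat.ListAction using (sum)
open import Data.Nat.ListAction.Properties using (sum-↭)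
open import Data.List using (List; []; _∷_; take)
open import Data.List.Membership.Propositional using (_∈_)
open import Data.List.Relation.Unary.Any using (here; there)
open import Data.List.Relation.Unary.Linked using (Linked; []; [-]; _∷_)
import Data.List.Relation.Unary.Linked as Linked
open import Data.List.Relation.Binary.Permutation.Propositional
  using (_↭_; ↭⇒↭ₛ; ↭-refl; ↭-prep; ↭-swap; ↭-trans; ↭-sym)
open import Data.List.Relation.Binary.Permutation.Propositional.Properties using (∈-resp-↭; drop-∷)
import Data.List.Relation.Binary.Pointwise as Pointwise
import Data.List.Relation.Unary.Sorted.TotalOrder.Properties as Sorted
import Data.List.Sort as Sort
open import Data.Product using (Σ; _×_; _,_; proj₂)
open import Data.Empty using (⊥-elim)
open import Relation.Nullary using (yes; no)
open import Relation.Binary.Bundles using (DecTotalOrder)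
open import Relation.Binary.PropositionalEquality
  using (_≡_; _≢_; refl; sym; trans; cong; subst; module ≡-Reasoning)
open import Relation.Binary.Properties.DecTotalOrder ≤-decTotalOrder using (≥-decTotalOrder)

Desc : List ℕ → Set
Desc = Linked (λ x y → y ≤ x)

sortDesc-desc : ∀ X → Desc (sortDesc X)
sortDesc-desc = Sort.sort-↗ ≥-decTotalOrder

sortDesc-↭ : ∀ X → sortDesc X ↭ X
sortDesc-↭ = Sort.sort-↭ ≥-decTotalOrder

desc-unique : ∀ {xs ys} → Desc xs → Desc ys → xs ↭ ys → xs ≡ ys
desc-unique xs↘ ys↘ xs↭ys = Pointwise.Pointwise-≡⇒≡
  (Sorted.↗↭↗⇒≋ (DecTotalOrder.totalOrder ≥-decTotalOrder) xs↘ ys↘ (↭⇒↭ₛ xs↭ys))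

desc-step : ∀ {L} → Desc L → ∀ i → at L (suc i) ≤ at L i
desc-step []         i       = z≤n
desc-step [-]        zero    = z≤n
desc-step [-]        (suc i) = z≤n
desc-step (y≤x ∷ D)  zero    = y≤x
desc-step (y≤x ∷ D)  (suc i) = desc-step D i

-- Sum of the first k entries; by definition sk k X ≡ prefix (sortDesc X) k.
prefix : List ℕ → ℕ → ℕ
prefix L k = sum (take k L)

prefix-suc : ∀ L k → prefix L (suc k) ≡ prefix L k + at L k
prefix-suc []       zero    = refl
prefix-suc []       (suc k) = refl
prefix-suc (x ∷ xs) zero    = +-comm x 0
prefix-suc (x ∷ xs) (suc k) =
  trans (cong (x +_) (prefix-suc xs k)) (sym (+-assoc x (prefix xs k) (at xs k)))

prefix-≤-sum : ∀ L k → prefix L k ≤ sum L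
prefix-≤-sum []       zero    = z≤n
prefix-≤-sum []       (suc k) = z≤n
prefix-≤-sum (x ∷ xs) zero    = z≤n
prefix-≤-sum (x ∷ xs) (suc k) = +-monoʳ-≤ x (prefix-≤-sum xs k)

desc-sum-zero : ∀ {L} → Desc L → at L 0 ≡ 0 → sum L ≡ 0
desc-sum-zero []        _    = refl
desc-sum-zero [-]       refl = refl
desc-sum-zero (y≤0 ∷ D) refl = desc-sum-zero D (n≤0⇒n≡0 y≤0)

prefix-vanishing : ∀ {L} → Desc L → ∀ k → at L k ≡ 0 → prefix L k ≡ sum L
prefix-vanishing {[]}     _ zero    _  = refl
prefix-vanishing {[]}     _ (suc k) _  = refl
prefix-vanishing {x ∷ xs} D zero    x0 = sym (desc-sum-zero D x0)
prefix-vanishing {x ∷ xs} D (suc k) z  = cong (x +_) (prefix-vanishing (Linked.tail D) k z)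

entry-positive : ∀ {S} T q → Desc S → sum T < sum S → prefix S q ≡ prefix T q → 0 < at S q
entry-positive {S} T q D T<S agree = n≢0⇒n>0 λ vanish → <⇒≱ T<S (begin
    sum S       ≡⟨ sym (prefix-vanishing D q vanish) ⟩
    prefix S q  ≡⟨ agree ⟩
    prefix T q  ≤⟨ prefix-≤-sum T q ⟩
    sum T       ∎)
  where open ≤-Reasoning

decAt : ℕ → List ℕ → List ℕ
decAt p       []       = []
decAt zero    (x ∷ xs) = (x ∸ 1) ∷ xs
decAt (suc p) (x ∷ xs) = x ∷ decAt p xs

sum-decAt : ∀ p L → 0 < at L p → suc (sum (decAt p L)) ≡ sum L
sum-decAt p       []           ()
sum-decAt zero    (suc x ∷ xs) _   = refl
sum-decAt (suc p) (x ∷ xs)     pos = trans (sym (+-suc x _)) (cong (x +_) (sum-decAt p xs pos))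

prefix-decAt-below : ∀ p L k → k ≤ p → prefix (decAt p L) k ≡ prefix L k
prefix-decAt-below p       []       k       _         = refl
prefix-decAt-below p       (x ∷ xs) zero    _         = refl
prefix-decAt-below (suc p) (x ∷ xs) (suc k) (s≤s k≤p) = cong (x +_) (prefix-decAt-below p xs k k≤p)

prefix-decAt-above : ∀ p L k → p < k → 0 < at L p → suc (prefix (decAt p L) k) ≡ prefix L k
prefix-decAt-above p       []           k       _         ()
prefix-decAt-above zero    (suc x ∷ xs) (suc k) _         _   = refl
prefix-decAt-above (suc p) (x ∷ xs)     (suc k) (s≤s p<k) pos =
  trans (sym (+-suc x _)) (cong (x +_) (prefix-decAt-above p xs k p<k pos))

decAt-desc : ∀ {L} → Desc L → ∀ p → at L (suc p) < at L p → Desc (decAt p L)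
decAt-desc []        p             _           = []
decAt-desc [-]       zero          _           = [-]
decAt-desc [-]       (suc p)       _           = [-]
decAt-desc (_ ∷ D)   zero          (s≤s y≤x-1) = y≤x-1 ∷ D
decAt-desc {_ ∷ y ∷ _} (y≤x ∷ D) (suc zero) drop = ≤-trans (m∸n≤m y 1) y≤x ∷ decAt-desc D zero drop
decAt-desc (y≤x ∷ D) (suc (suc p)) drop        = y≤x ∷ decAt-desc D (suc p) drop

at-∈ : ∀ L i → 0 < at L i → at L i ∈ L
at-∈ []       i       ()
at-∈ (x ∷ xs) zero    _   = here refl
at-∈ (x ∷ xs) (suc i) pos = there (at-∈ xs i pos)

removeOne-↭ : ∀ {a} X → a ∈ X → X ↭ a ∷ removeOne a X
removeOne-↭ {a} (x ∷ xs) a∈ with a ≟ x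
... | yes refl = ↭-refl
removeOne-↭ (x ∷ xs) (here a≡x)  | no a≢x = ⊥-elim (a≢x a≡x)
removeOne-↭ (x ∷ xs) (there a∈) | no _   =
  ↭-trans (↭-prep x (removeOne-↭ xs a∈)) (↭-swap x _ ↭-refl)

decAt-↭ : ∀ p L → 0 < at L p →
          Σ (List ℕ) λ R → (L ↭ at L p ∷ R) × (decAt p L ↭ (at L p ∸ 1) ∷ R)
decAt-↭ p       []       ()
decAt-↭ zero    (x ∷ xs) _   = xs , ↭-refl , ↭-refl
decAt-↭ (suc p) (x ∷ xs) pos with decAt-↭ p xs pos
... | R , xs↭ , dec↭ = x ∷ R , ↭-trans (↭-prep x xs↭) (↭-swap x _ ↭-refl)
                             , ↭-trans (↭-prep x dec↭) (↭-swap x _ ↭-refl)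

decAt-↭-replace : ∀ {L X a} p → L ↭ X → at L p ≡ a → 0 < a →
                  decAt p L ↭ (a ∸ 1) ∷ removeOne a X
decAt-↭-replace {L} {X} p L↭X refl pos with decAt-↭ p L pos
... | R , L↭aR , dec↭aR =
  ↭-trans dec↭aR (↭-prep _ (drop-∷ (↭-trans (↭-sym L↭aR) (↭-trans L↭X (removeOne-↭ X a∈X)))))
  where
  a∈X : at L p ∈ X
  a∈X = ∈-resp-↭ L↭X (at-∈ L p pos)

sortDesc-replace : ∀ {L X a} p → Desc L → L ↭ X → at L p ≡ a → 0 < a → at L (suc p) < a →
                   sortDesc ((a ∸ 1) ∷ removeOne a X) ≡ decAt p L
sortDesc-replace p D L↭X refl pos drop = desc-unique (sortDesc-desc _) (decAt-desc D p drop)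
  (↭-trans (sortDesc-↭ _) (↭-sym (decAt-↭-replace p L↭X refl pos)))

record RunEnd (L : List ℕ) (q : ℕ) : Set where
  field
    end       : ℕ
    start≤end : q ≤ end
    constant  : ∀ i → q ≤ i → i ≤ end → at L i ≡ at L q
    drops     : at L (suc end) < at L q

run-here : ∀ {L} → at L 1 < at L 0 → RunEnd L 0
run-here drop = record
  { end = 0 ; start≤end = z≤n ; constant = λ { zero _ _ → refl ; (suc _) _ () } ; drops = drop }

run-extend : ∀ {x xs} → RunEnd (x ∷ xs) 0 → RunEnd (x ∷ x ∷ xs) 0
run-extend r = record
  { end = suc end ; start≤end = z≤n ; drops = drops
  ; constant = λ { zero _ _ → refl ; (suc i) _ (s≤s i≤end) → constant i z≤n i≤end } }
  where open RunEnd r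

run-shift : ∀ {x xs q} → RunEnd xs q → RunEnd (x ∷ xs) (suc q)
run-shift r = record
  { end = suc end ; start≤end = s≤s start≤end ; drops = drops
  ; constant = λ { zero () _ ; (suc i) (s≤s q≤i) (s≤s i≤end) → constant i q≤i i≤end } }
  where open RunEnd r

runEnd : ∀ {L} → Desc L → ∀ q → 0 < at L q → RunEnd L q
runEnd []                    q       ()
runEnd [-]                   zero    pos = run-here pos
runEnd [-]                   (suc q) ()
runEnd (_ ∷ D)               (suc q) pos = run-shift (runEnd D q pos)
runEnd {x ∷ y ∷ _} (y≤x ∷ D) zero    pos with y ≟ x
... | no y≢x   = run-here (≤∧≢⇒< y≤x y≢x)
... | yes refl = run-extend (runEnd D zero pos)

excess-descends : ∀ {S T} k → Desc T → at S (suc k) ≡ at S k →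
                  prefix S (suc (suc k)) ≤ suc (prefix T (suc (suc k))) →
                  prefix S (suc k) ≡ suc (prefix T (suc k)) → prefix T k < prefix S k
excess-descends {S} {T} k D flat bound excess =
  +-cancelʳ-≤ (at S k) (suc (prefix T k)) (prefix S k) (begin
    suc (prefix T k) + at S k  ≤⟨ +-monoʳ-≤ (suc (prefix T k)) (≤-trans a≤y₁ (desc-step D k)) ⟩
    suc (prefix T k) + at T k  ≡⟨ cong suc (sym (prefix-suc T k)) ⟩
    suc (prefix T (suc k))     ≡⟨ sym excess ⟩
    prefix S (suc k)           ≡⟨ prefix-suc S k ⟩
    prefix S k + at S k        ∎)
  where
  open ≤-Reasoning
  a≤y₁ : at S k ≤ at T (suc k)
  a≤y₁ = +-cancelˡ-≤ (prefix S (suc k)) _ _ (begin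
    prefix S (suc k) + at S k                ≡⟨ cong (prefix S (suc k) +_) (sym flat) ⟩
    prefix S (suc k) + at S (suc k)          ≡⟨ sym (prefix-suc S (suc k)) ⟩
    prefix S (suc (suc k))                   ≤⟨ bound ⟩
    suc (prefix T (suc (suc k)))             ≡⟨ cong suc (prefix-suc T (suc k)) ⟩
    suc (prefix T (suc k)) + at T (suc k)    ≡⟨ cong (_+ at T (suc k)) (sym excess) ⟩
    prefix S (suc k) + at T (suc k)          ∎)

no-excess-on-run : ∀ {S T} q p → Desc T → (∀ k → prefix S k ≤ suc (prefix T k)) →
                   (∀ k → k ≤ q → prefix S k ≡ prefix T k) →
                   (∀ i → q ≤ i → i ≤ p → at S i ≡ at S q) →
                   ∀ k → k ≤ p → prefix S k ≢ suc (prefix T k)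
no-excess-on-run {S} {T} q p D bound agree constant zero    _   ()
no-excess-on-run {S} {T} q p D bound agree constant (suc k) k<p excess with suc k ≤? q
... | yes k<q = 1+n≢n (sym (trans (sym (agree (suc k) k<q)) excess))
... | no  k≮q = no-excess-on-run q p D bound agree constant k k≤p excess-at-k
  where
  q≤k : q ≤ k
  q≤k = s≤s⁻¹ (≰⇒> k≮q)
  k≤p : k ≤ p
  k≤p = ≤-trans (n≤1+n k) k<p
  flat : at S (suc k) ≡ at S k
  flat = trans (constant (suc k) (≤-trans q≤k (n≤1+n k)) k<p) (sym (constant k q≤k k≤p))
  excess-at-k : prefix S k ≡ suc (prefix T k)
  excess-at-k = ≤-antisym (bound k) (excess-descends k D flat (bound (suc (suc k))) excess)

proposition2 : (X Y : List ℕ) (m : ℕ) →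
    suc (stot Y) ≡ stot X →
    (∀ k → sk k Y ≤ sk k X × sk k X ≤ suc (sk k Y)) →
    1 ≤ m →
    (∀ k → 1 ≤ k → k < m → sk k X ≡ sk k Y) →
    0 < largest m X × Y ≻ ((largest m X ∸ 1) ∷ removeOne (largest m X) X)
proposition2 X Y zero    _     _      ()  _
proposition2 X Y (suc q) total bounds _   agree = positive , stot-equal , dominated
  where
  S = sortDesc X
  T = sortDesc Y
  Z = (at S q ∸ 1) ∷ removeOne (at S q) X

  upper : ∀ k → prefix S k ≤ suc (prefix T k)
  upper k = proj₂ (bounds k)

  agree-upto-q : ∀ k → k ≤ q → prefix S k ≡ prefix T k
  agree-upto-q zero    _   = refl
  agree-upto-q (suc k) k<q = agree (suc k) (s≤s z≤n) (s≤s k<q)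

  positive : 0 < at S q
  positive = entry-positive T q (sortDesc-desc X)
    (≤-reflexive (trans (cong suc (sum-↭ (sortDesc-↭ Y))) (trans total (sym (sum-↭ (sortDesc-↭ X))))))
    (agree-upto-q q ≤-refl)

  open RunEnd (runEnd (sortDesc-desc X) q positive)

  end-positive : 0 < at S end
  end-positive = subst (0 <_) (sym (constant end start≤end ≤-refl)) positive

  sortedZ : sortDesc Z ≡ decAt end S
  sortedZ = sortDesc-replace end (sortDesc-desc X) (sortDesc-↭ X)
              (constant end start≤end ≤-refl) positive drops

  stot-equal : stot Y ≡ stot Z
  stot-equal = suc-injective (begin
    suc (stot Y)                ≡⟨ total ⟩
    stot X                      ≡⟨ sym (sum-↭ (sortDesc-↭ X)) ⟩
    sum S                       ≡⟨ sym (sum-decAt end S end-positive) ⟩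
    suc (sum (decAt end S))     ≡⟨ cong (λ L → suc (sum L)) (sym sortedZ) ⟩
    suc (sum (sortDesc Z))      ≡⟨ cong suc (sum-↭ (sortDesc-↭ Z)) ⟩
    suc (stot Z)                ∎)
    where open ≡-Reasoning

  dominated-decAt : ∀ k → prefix (decAt end S) k ≤ prefix T k
  dominated-decAt k with k ≤? end
  ... | yes k≤end = ≤-trans (≤-reflexive (prefix-decAt-below end S k k≤end))
      (s≤s⁻¹ (≤∧≢⇒< (upper k) (no-excess-on-run q end (sortDesc-desc Y) upper agree-upto-q constant k k≤end)))
  ... | no  k≰end = s≤s⁻¹ (subst (_≤ suc (prefix T k))
      (sym (prefix-decAt-above end S k (≰⇒> k≰end) end-positive)) (upper k))

  dominated : ∀ k → sk k Z ≤ sk k Y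
  dominated k = subst (λ L → prefix L k ≤ prefix T k) (sym sortedZ) (dominated-decAt k)
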